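{- For all integers $s\geq 1$ and positive integers $l$ with $\binom{l}{3}\geq s+3\geq l$, there exists an $(N,s+3,2s+1)$-suitable core with $N=(s+3)(s-1)+l$.
   Context: Let $v,N,t$ be positive integers and $[v]=\{1,\dots,v\}$. An $N\times v$ array $C$ whose rows are permutations of $[v]$ is an $(N,v,t)$-suitable core if the following holds: choose $N$ new distinct symbols, prepend a different one of them to each row of $C$, and append the remaining $N-1$ new symbols (in arbitrary order) to that row; the resulting $N\times(v+N)$ array has the property that for every $t$-element subset $S$ of the $v+N$ symbols and every $\sigma\in S$ there is a row in which $\sigma$ occurs before every element of $S\setminus\{\sigma\}$. (Equivalently: for every symbol $\sigma\in[v]$ and every subset $T\subseteq[v]\setminus\{\sigma\}$, the number of rows of $C$ in which $\sigma$ precedes every element of $[v]\setminus(T\cup\{\sigma\})$ is at least $t+1-v+|T|$.) -}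

module Defs where

open import Data.Nat using (ℕ; suc; _+_; _<_)
open import Data.Fin using (Fin; toℕ; _≟_)
open import Relation.Nullary using (yes; no)
open import Data.Fin.Permutation using (Permutation′; _⟨$⟩ˡ_)
open import Data.Sum using (_⊎_; inj₁; inj₂)
open import Data.List using (List; length)
open import Data.List.Relation.Unary.Unique.Propositional using (Unique)
open import Data.List.Membership.Propositional using (_∈_)
open import Data.Product using (∃)
open import Relation.Binary.PropositionalEquality using (_≡_; _≢_)

-- An N × v array whose rows are permutations of [v] (here [v] = Fin v):
-- row i, read left to right, is  j ↦ C i ⟨$⟩ʳ j ; the position of symbol a
-- in row i is  C i ⟨$⟩ˡ a .
Array : ℕ → ℕ → Set
Array N v = Fin N → Permutation′ v

-- Symbols of the extended array: the v old symbols and N new symbols.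
-- New symbol  inj₂ i  is the one prepended to row i.
Sym : ℕ → ℕ → Set
Sym N v = Fin v ⊎ Fin N

-- Orders of the appended symbols: for row i, the remaining N-1 new symbols
-- are appended in the order given by the permutation  A i  of Fin N
-- (new symbol k sits at appended-rank  A i ⟨$⟩ˡ k ; the entry for i itself
-- is ignored since i is prepended).
AppendOrder : ℕ → Set
AppendOrder N = Fin N → Permutation′ N

pos : ∀ {N v} → Array N v → AppendOrder N → Fin N → Sym N v → ℕ
pos C A i (inj₁ a) = suc (toℕ (C i ⟨$⟩ˡ a))
pos {N} {v} C A i (inj₂ k) with i ≟ k
... | yes _ = 0
... | no  _ = suc (v + toℕ (A i ⟨$⟩ˡ k))

ExtendedProperty : ∀ {N v} → ℕ → Array N v → AppendOrder N → Set
ExtendedProperty {N} {v} t C A =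
  (S : List (Sym N v)) → Unique S → length S ≡ t →
  (σ : Sym N v) → σ ∈ S →
  ∃ λ (i : Fin N) → (τ : Sym N v) → τ ∈ S → τ ≢ σ → pos C A i σ < pos C A i τ

SuitableCore : (N v t : ℕ) → Array N v → Set
SuitableCore N v t C = (A : AppendOrder N) → ExtendedProperty t C A

module Submission where

-- Write m = s - 1, so there are v = s + 3 = 4 + m old symbols. Give every symbol x a block B(x):
-- a 3-subset of the first l symbols, distinct symbols getting distinct blocks and x ∈ B(x) for
-- x < l; this is possible as l ≤ v ≤ l C 3. The core has one row for every ordered pair (x, y) with
-- y ∉ B(x) ∪ {x}, that is m rows led by x plus one more when x < l, so N = v m + l. Such a row
-- starts with x, y and then a symbol of B(x) ∩ B(y) (if any); as two blocks share at most two
-- symbols, the rows (x, y) and (y, x) can be made to cover all of B(x) ∩ B(y) ∖ {x, y}.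
--
-- A new symbol always leads in its own row. For an old symbol a in a (2s+1)-set S it suffices to
-- find a row whose own new symbol is not in S and in which a precedes the other old symbols of S.
-- Each of the v + m = 2s + 2 labels -- an old symbol y, or one of the m ordinary rows led by a --
-- is realised either by an element of S (y itself) or by such a row: a row led by a, a row (y, a),
-- or a row through y and a fixed outsider y₀ ∉ S with a ∈ B(y₀) having third symbol a. These
-- realisations are pairwise distinct, so one of them is a row outside S.

open import Defs
open import Data.Nat using (ℕ; zero; suc; _+_; _*_; _∸_; _≤_; _≥_; _<_; z≤n; s≤s; _<?_)
open import Data.Nat.Combinatorics using (_C_; nC1≡n; nCk+nC[k+1]≡[n+1]C[k+1])
open import Data.Nat.Tactic.RingSolver using (solve-∀)
open import Data.Product using (∃; Σ; Σ-syntax; _×_; _,_; proj₁; proj₂)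
open import Data.Nat.Properties
open import Data.Fin as Fin using (Fin; #_; toℕ; fromℕ<; inject≤; splitAt; join; remQuot; combine)
open import Data.Fin.Properties
  using ( toℕ-injective; toℕ<n; toℕ-fromℕ<; toℕ-inject≤; splitAt-<; splitAt-join; join-splitAt
        ; remQuot-combine; any?; all?; ¬∀⟶∃¬; pigeonhole )
open import Data.Fin.Permutation using (Permutation′; _⟨$⟩ʳ_; _⟨$⟩ˡ_; _∘ₚ_; transpose; inverseˡ; flip; id)
open import Data.Sum as Sum using (_⊎_; inj₁; inj₂)
open import Data.List using (List; []; _∷_; _++_; map; lookup; length; upTo)
open import Data.List.Properties using (length-++; length-map; length-upTo)
open import Data.List.Membership.Propositional.Properties using (∈-map⁻; ∈-lookup)
open import Data.List.Membership.Propositional using (_∈_; _∉_)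
open import Data.List.Membership.DecPropositional as DecMembership using ()
open import Data.List.Relation.Unary.All as All using (All; []; _∷_)
import Data.List.Relation.Unary.All.Properties as All
open import Data.List.Relation.Unary.Any using (index)
open import Data.List.Relation.Unary.Any.Properties using (lookup-index)
open import Data.List.Relation.Unary.Unique.Propositional using (Unique)
import Data.List.Relation.Unary.Unique.Propositional.Properties as Unique
open import Data.List.Relation.Unary.AllPairs using ([]; _∷_)
open import Data.Empty using (⊥; ⊥-elim)
open import Function using (_∘_; case_of_)
open import Data.Sum.Properties using (≡-dec)
open import Relation.Binary.Definitions using (DecidableEquality; tri<; tri≈; tri>)
open import Relation.Binary.PropositionalEquality
open import Relation.Nullary using (¬_; yes; no; Dec; contradiction)
open import Relation.Nullary.Decidable using (_⊎-dec_; _×-dec_; ¬?)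
open import Relation.Unary using (Pred; Decidable)
open import Level using (0ℓ)

opaque
  choose : ∀ {n p} {P : Pred (Fin n) p} → Decidable P → Fin n → Fin n
  choose P? d with any? P?
  ... | yes (w , _) = w
  ... | no _ = d

  choose-spec : ∀ {n p} {P : Pred (Fin n) p} (P? : Decidable P) d → ∃ P → P (choose P? d)
  choose-spec P? d ex with any? P?
  ... | yes (_ , pw) = pw
  ... | no ¬ex = contradiction ex ¬ex

  choose-default : ∀ {n p} {P : Pred (Fin n) p} (P? : Decidable P) d → P (choose P? d) ⊎ choose P? d ≡ d
  choose-default P? d with any? P?
  ... | yes (_ , pw) = inj₁ pw
  ... | no _ = inj₂ refl

module _ {A : Set} (_≟_ : DecidableEquality A) where
  open DecMembership _≟_ using (_∈?_)

  pigeonhole-∉ : ∀ {n} (xs : List A) → length xs < n →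
    (f : Fin n → A) → (∀ {i j} → f i ≡ f j → i ≡ j) → ∃ λ j → f j ∉ xs
  pigeonhole-∉ xs len f f-inj with all? (λ j → f j ∈? xs)
  ... | no ¬all = ¬∀⟶∃¬ _ _ (λ j → f j ∈? xs) ¬all
  ... | yes all with pigeonhole len (λ j → index (all j))
  ... | i , j , i<j , same = contradiction (f-inj f[i]≡f[j]) (λ i≡j → <-irrefl (cong toℕ i≡j) i<j)
    where
    f[i]≡f[j] : f i ≡ f j
    f[i]≡f[j] = trans (lookup-index (all i)) (trans (cong (lookup xs) same) (sym (lookup-index (all j))))

module _ {n : ℕ} where

  ⟨$⟩ʳ-injective : (π : Permutation′ n) {i j : Fin n} → π ⟨$⟩ʳ i ≡ π ⟨$⟩ʳ j → i ≡ j
  ⟨$⟩ʳ-injective π {i} {j} eq = trans (sym (inverseˡ π)) (trans (cong (π ⟨$⟩ˡ_) eq) (inverseˡ π))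

  redirect : Permutation′ n → Fin n → Fin n → Permutation′ n
  redirect π x p = π ∘ₚ transpose (π ⟨$⟩ʳ x) p

  redirect-hit : ∀ π x p → redirect π x p ⟨$⟩ʳ x ≡ p
  redirect-hit π x p with π ⟨$⟩ʳ x Fin.≟ π ⟨$⟩ʳ x
  ... | yes _ = refl
  ... | no ≢ = contradiction refl ≢

  redirect-miss : ∀ π x p {y} → y ≢ x → π ⟨$⟩ʳ y ≢ p → redirect π x p ⟨$⟩ʳ y ≡ π ⟨$⟩ʳ y
  redirect-miss π x p {y} y≢x πy≢p with π ⟨$⟩ʳ y Fin.≟ π ⟨$⟩ʳ x
  ... | yes eq = contradiction (⟨$⟩ʳ-injective π eq) y≢x
  ... | no _ with π ⟨$⟩ʳ y Fin.≟ p
  ...   | yes eq = contradiction eq πy≢p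
  ...   | no _ = refl

  Sends : Permutation′ n → Fin n × Fin n → Set
  Sends π (x , p) = π ⟨$⟩ʳ x ≡ p

  arrange : (xps : List (Fin n × Fin n)) → Unique (map proj₁ xps) → Unique (map proj₂ xps) →
    Σ[ π ∈ Permutation′ n ] All (Sends π) xps
  arrange [] _ _ = id , []
  arrange ((x , p) ∷ xps) (x∉ ∷ xs-unique) (p∉ ∷ ps-unique) =
    redirect π x p , redirect-hit π x p ∷ All.zipWith keep (π-sends , All.zip (All.map⁻ x∉ , All.map⁻ p∉))
    where
    π = proj₁ (arrange xps xs-unique ps-unique)
    π-sends = proj₂ (arrange xps xs-unique ps-unique)
    keep : ∀ {yq} → Sends π yq × x ≢ proj₁ yq × p ≢ proj₂ yq → Sends (redirect π x p) yq
    keep (πy≡q , x≢y , p≢q) =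
      trans (redirect-miss π x p (x≢y ∘ sym) (λ πy≡p → p≢q (trans (sym πy≡p) πy≡q))) πy≡q

  precedes-if-earlier-absent : (π : Permutation′ n) {P : Pred (Fin n) 0ℓ} {a : Fin n} →
    (∀ z → toℕ (π ⟨$⟩ʳ z) < toℕ (π ⟨$⟩ʳ a) → ¬ P z) →
    ∀ z → P z → z ≢ a → toℕ (π ⟨$⟩ʳ a) < toℕ (π ⟨$⟩ʳ z)
  precedes-if-earlier-absent π {a = a} earlier-absent z Pz z≢a
    with <-cmp (toℕ (π ⟨$⟩ʳ z)) (toℕ (π ⟨$⟩ʳ a))
  ... | tri< before _ _ = contradiction Pz (earlier-absent z before)
  ... | tri≈ _ same _ = contradiction (⟨$⟩ʳ-injective π (toℕ-injective same)) z≢a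
  ... | tri> _ _ after = after

toℕ<⇒≢ : ∀ {n} {x y : Fin n} → toℕ x < toℕ y → x ≢ y
toℕ<⇒≢ x<y refl = <-irrefl refl x<y

toℕ<1 : ∀ {n} {p : Fin (suc n)} → toℕ p < 1 → p ≡ Fin.zero
toℕ<1 {p = Fin.zero} _ = refl
toℕ<1 {p = Fin.suc _} (s≤s ())

toℕ<2 : ∀ {n} {p : Fin (suc (suc n))} → toℕ p < 2 → p ≡ Fin.zero ⊎ p ≡ Fin.suc Fin.zero
toℕ<2 {p = Fin.zero} _ = inj₁ refl
toℕ<2 {p = Fin.suc Fin.zero} _ = inj₂ refl
toℕ<2 {p = Fin.suc (Fin.suc _)} (s≤s (s≤s ()))

module _ {A : Set} where

  infix 4 _∈₃_ _⊆₃_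

  _∈₃_ : A → A × A × A → Set
  z ∈₃ (a , b , c) = z ≡ a ⊎ z ≡ b ⊎ z ≡ c

  _⊆₃_ : A × A × A → A × A × A → Set
  t ⊆₃ u = ∀ {z} → z ∈₃ t → z ∈₃ u

  Distinct₃ : A × A × A → Set
  Distinct₃ (a , b , c) = a ≢ b × a ≢ c × b ≢ c

  ∈₃-dec : DecidableEquality A → ∀ z t → Dec (z ∈₃ t)
  ∈₃-dec _≟_ z (a , b , c) = z ≟ a ⊎-dec z ≟ b ⊎-dec z ≟ c

  distinct₃? : DecidableEquality A → ∀ t → Dec (Distinct₃ t)
  distinct₃? _≟_ (a , b , c) = ¬? (a ≟ b) ×-dec ¬? (a ≟ c) ×-dec ¬? (b ≟ c)

  ⊆₃-intro : ∀ {a b c u} → a ∈₃ u → b ∈₃ u → c ∈₃ u → (a , b , c) ⊆₃ u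
  ⊆₃-intro a∈u _ _ (inj₁ refl) = a∈u
  ⊆₃-intro _ b∈u _ (inj₂ (inj₁ refl)) = b∈u
  ⊆₃-intro _ _ c∈u (inj₂ (inj₂ refl)) = c∈u

  ⊆₃-swap : ∀ {a b c} → (a , b , c) ⊆₃ (b , a , c)
  ⊆₃-swap = ⊆₃-intro (inj₂ (inj₁ refl)) (inj₁ refl) (inj₂ (inj₂ refl))

  ⊆₃-rotate : ∀ {a b c} → (a , b , c) ⊆₃ (c , a , b)
  ⊆₃-rotate = ⊆₃-intro (inj₂ (inj₁ refl)) (inj₂ (inj₂ refl)) (inj₁ refl)

  private
    not-distinct-in-pair : ∀ {p q r b c : A} → p ≡ b ⊎ p ≡ c → q ≡ b ⊎ q ≡ c → r ≡ b ⊎ r ≡ c →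
      ¬ Distinct₃ (p , q , r)
    not-distinct-in-pair (inj₁ refl) (inj₁ refl) _ (p≢q , _) = p≢q refl
    not-distinct-in-pair (inj₂ refl) (inj₂ refl) _ (p≢q , _) = p≢q refl
    not-distinct-in-pair (inj₁ refl) (inj₂ refl) (inj₁ refl) (_ , p≢r , _) = p≢r refl
    not-distinct-in-pair (inj₂ refl) (inj₁ refl) (inj₂ refl) (_ , p≢r , _) = p≢r refl
    not-distinct-in-pair (inj₁ refl) (inj₂ refl) (inj₂ refl) (_ , _ , q≢r) = q≢r refl
    not-distinct-in-pair (inj₂ refl) (inj₁ refl) (inj₁ refl) (_ , _ , q≢r) = q≢r refl

  head-∈₃-of-distinct : ∀ {w a b c} → Distinct₃ w → w ⊆₃ (a , b , c) → a ∈₃ w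
  head-∈₃-of-distinct {w} w-distinct w⊆t
    with w⊆t (inj₁ refl) | w⊆t (inj₂ (inj₁ refl)) | w⊆t (inj₂ (inj₂ refl))
  ... | inj₁ p≡a | _ | _ = inj₁ (sym p≡a)
  ... | _ | inj₁ q≡a | _ = inj₂ (inj₁ (sym q≡a))
  ... | _ | _ | inj₁ r≡a = inj₂ (inj₂ (sym r≡a))
  ... | inj₂ p∈bc | inj₂ q∈bc | inj₂ r∈bc = contradiction w-distinct (not-distinct-in-pair p∈bc q∈bc r∈bc)

  distinct-⊆₃-reverse : ∀ {w t} → Distinct₃ w → w ⊆₃ t → t ⊆₃ w
  distinct-⊆₃-reverse w-distinct w⊆t =
    ⊆₃-intro (head-∈₃-of-distinct w-distinct w⊆t)
             (head-∈₃-of-distinct w-distinct (⊆₃-swap ∘ w⊆t))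
             (head-∈₃-of-distinct w-distinct (⊆₃-rotate ∘ w⊆t))

module _ {A B : Set} (f : A → B) where

  map₃ : A × A × A → B × B × B
  map₃ (a , b , c) = f a , f b , f c

  ∈₃-map⁺ : ∀ {z t} → z ∈₃ t → f z ∈₃ map₃ t
  ∈₃-map⁺ (inj₁ refl) = inj₁ refl
  ∈₃-map⁺ (inj₂ (inj₁ refl)) = inj₂ (inj₁ refl)
  ∈₃-map⁺ (inj₂ (inj₂ refl)) = inj₂ (inj₂ refl)

  module _ (f-injective : ∀ {x y} → f x ≡ f y → x ≡ y) where

    ∈₃-map⁻ : ∀ {z t} → f z ∈₃ map₃ t → z ∈₃ t
    ∈₃-map⁻ (inj₁ eq) = inj₁ (f-injective eq)
    ∈₃-map⁻ (inj₂ (inj₁ eq)) = inj₂ (inj₁ (f-injective eq))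
    ∈₃-map⁻ (inj₂ (inj₂ eq)) = inj₂ (inj₂ (f-injective eq))

    distinct-map⁺ : ∀ {t} → Distinct₃ t → Distinct₃ (map₃ t)
    distinct-map⁺ (a≢b , a≢c , b≢c) = a≢b ∘ f-injective , a≢c ∘ f-injective , b≢c ∘ f-injective

  distinct-map⁻ : ∀ {t} → Distinct₃ (map₃ t) → Distinct₃ t
  distinct-map⁻ (fa≢fb , fa≢fc , fb≢fc) = fa≢fb ∘ cong f , fa≢fc ∘ cong f , fb≢fc ∘ cong f

Sorted : ℕ × ℕ × ℕ → Set
Sorted (a , b , c) = a < b × b < c

sorted-bounds : ∀ {a b c z} → Sorted (a , b , c) → z ∈₃ (a , b , c) → a ≤ z × z ≤ c
sorted-bounds (a<b , b<c) (inj₁ refl) = ≤-refl , <⇒≤ (<-trans a<b b<c)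
sorted-bounds (a<b , b<c) (inj₂ (inj₁ refl)) = <⇒≤ a<b , <⇒≤ b<c
sorted-bounds (a<b , b<c) (inj₂ (inj₂ refl)) = <⇒≤ (<-trans a<b b<c) , ≤-refl

sorted-⊆₃-antisym : ∀ {t u} → Sorted t → Sorted u → t ⊆₃ u → u ⊆₃ t → t ≡ u
sorted-⊆₃-antisym {a , b , c} {a′ , b′ , c′} t-sorted@(a<b , b<c) u-sorted t⊆u u⊆t =
  cong₂ _,_ a≡a′ (cong₂ _,_ b≡b′ c≡c′)
  where
  a≡a′ : a ≡ a′
  a≡a′ = ≤-antisym (proj₁ (sorted-bounds t-sorted (u⊆t (inj₁ refl))))
                   (proj₁ (sorted-bounds u-sorted (t⊆u (inj₁ refl))))
  c≡c′ : c ≡ c′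
  c≡c′ = ≤-antisym (proj₂ (sorted-bounds u-sorted (t⊆u (inj₂ (inj₂ refl)))))
                   (proj₂ (sorted-bounds t-sorted (u⊆t (inj₂ (inj₂ refl)))))
  b≡b′ : b ≡ b′
  b≡b′ with t⊆u (inj₂ (inj₁ refl))
  ... | inj₁ b≡a′ = contradiction (trans b≡a′ (sym a≡a′)) (>⇒≢ a<b)
  ... | inj₂ (inj₁ b≡b′) = b≡b′
  ... | inj₂ (inj₂ b≡c′) = contradiction (trans b≡c′ (sym c≡c′)) (<⇒≢ b<c)

sorted-determined-by-three : ∀ {w t u} → Sorted t → Sorted u → Distinct₃ w → w ⊆₃ t → w ⊆₃ u → t ≡ u
sorted-determined-by-three t-sorted u-sorted w-distinct w⊆t w⊆u =
  sorted-⊆₃-antisym t-sorted u-sorted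
    (w⊆u ∘ distinct-⊆₃-reverse w-distinct w⊆t)
    (w⊆t ∘ distinct-⊆₃-reverse w-distinct w⊆u)

length-++-map : ∀ {A B : Set} (xs : List B) (f : A → B) ys → length (xs ++ map f ys) ≡ length xs + length ys
length-++-map xs f ys = trans (length-++ xs) (cong (length xs +_) (length-map f ys))

OrdinaryPair : ℕ → ℕ × ℕ → Set
OrdinaryPair n (a , b) = a < b × 2 ≤ b × b < n

ordinaryPairs : ℕ → List (ℕ × ℕ)
ordinaryPairs (suc n@(suc (suc _))) = ordinaryPairs n ++ map (_, n) (upTo n)
ordinaryPairs _ = []

ordinaryPairs-all : ∀ n → All (OrdinaryPair n) (ordinaryPairs n)
ordinaryPairs-all (suc n@(suc (suc _))) =
  All.++⁺ (All.map (λ (a<b , 2≤b , b<n) → a<b , 2≤b , m≤n⇒m≤1+n b<n) (ordinaryPairs-all n))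
          (All.map⁺ (All.applyUpTo⁺₁ (λ a → a) n (λ a<n → a<n , s≤s (s≤s z≤n) , ≤-refl)))
ordinaryPairs-all 0 = []
ordinaryPairs-all 1 = []
ordinaryPairs-all 2 = []

ordinaryPairs-unique : ∀ n → Unique (ordinaryPairs n)
ordinaryPairs-unique (suc n@(suc (suc _))) =
  Unique.++⁺ (ordinaryPairs-unique n) (Unique.map⁺ (cong proj₁) (Unique.upTo⁺ n)) disjoint
  where
  disjoint : ∀ {p} → ¬ (p ∈ ordinaryPairs n × p ∈ map (_, n) (upTo n))
  disjoint (p∈old , p∈new) with ∈-map⁻ _ p∈new
  ... | _ , _ , refl = <-irrefl refl (proj₂ (proj₂ (All.lookup (ordinaryPairs-all n) p∈old)))
ordinaryPairs-unique 0 = []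
ordinaryPairs-unique 1 = []
ordinaryPairs-unique 2 = []

length-ordinaryPairs : ∀ n → length (ordinaryPairs (2 + n)) + 1 ≡ (2 + n) C 2
length-ordinaryPairs zero = refl
length-ordinaryPairs (suc n) = begin
  length (ordinaryPairs (2 + n) ++ map (_, 2 + n) (upTo (2 + n))) + 1
    ≡⟨ cong (_+ 1) (trans (length-++-map (ordinaryPairs (2 + n)) (_, 2 + n) (upTo (2 + n)))
                            (cong (length (ordinaryPairs (2 + n)) +_) (length-upTo (2 + n)))) ⟩
  length (ordinaryPairs (2 + n)) + (2 + n) + 1
    ≡⟨ rearrange (length (ordinaryPairs (2 + n))) (2 + n) ⟩
  (2 + n) + (length (ordinaryPairs (2 + n)) + 1)
    ≡⟨ cong₂ _+_ (sym (nC1≡n (2 + n))) (length-ordinaryPairs n) ⟩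
  (2 + n) C 1 + (2 + n) C 2
    ≡⟨ nCk+nC[k+1]≡[n+1]C[k+1] (2 + n) 1 ⟩
  (3 + n) C 2 ∎
  where
  open ≡-Reasoning
  rearrange : ∀ p k → p + k + 1 ≡ k + (p + 1)
  rearrange = solve-∀

OrdinaryTriple : ℕ → ℕ × ℕ × ℕ → Set
OrdinaryTriple l (a , b , c) = a < b × 2 ≤ b × b < c × 4 ≤ c × c < l

ordinaryTriples : ℕ → List (ℕ × ℕ × ℕ)
ordinaryTriples (suc l@(suc (suc (suc (suc _))))) =
  ordinaryTriples l ++ map (λ (a , b) → a , b , l) (ordinaryPairs l)
ordinaryTriples _ = []

ordinaryTriples-all : ∀ l → All (OrdinaryTriple l) (ordinaryTriples l)
ordinaryTriples-all (suc l@(suc (suc (suc (suc _))))) =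
  All.++⁺ (All.map (λ (a<b , 2≤b , b<c , 4≤c , c<l) → a<b , 2≤b , b<c , 4≤c , m≤n⇒m≤1+n c<l)
                   (ordinaryTriples-all l))
          (All.map⁺ (All.map (λ (a<b , 2≤b , b<l) → a<b , 2≤b , b<l , s≤s (s≤s (s≤s (s≤s z≤n))) , ≤-refl)
                             (ordinaryPairs-all l)))
ordinaryTriples-all 0 = []
ordinaryTriples-all 1 = []
ordinaryTriples-all 2 = []
ordinaryTriples-all 3 = []
ordinaryTriples-all 4 = []

ordinaryTriples-unique : ∀ l → Unique (ordinaryTriples l)
ordinaryTriples-unique (suc l@(suc (suc (suc (suc _))))) =
  Unique.++⁺ (ordinaryTriples-unique l) (Unique.map⁺ (λ { refl → refl }) (ordinaryPairs-unique l)) disjoint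
  where
  disjoint : ∀ {t} → ¬ (t ∈ ordinaryTriples l × t ∈ map (λ (a , b) → a , b , l) (ordinaryPairs l))
  disjoint (t∈old , t∈new) with ∈-map⁻ _ t∈new
  ... | _ , _ , refl = <-irrefl refl (proj₂ (proj₂ (proj₂ (proj₂ (All.lookup (ordinaryTriples-all l) t∈old)))))
ordinaryTriples-unique 0 = []
ordinaryTriples-unique 1 = []
ordinaryTriples-unique 2 = []
ordinaryTriples-unique 3 = []
ordinaryTriples-unique 4 = []

length-ordinaryTriples : ∀ n → length (ordinaryTriples (4 + n)) + (4 + n) ≡ (4 + n) C 3
length-ordinaryTriples zero = refl
length-ordinaryTriples (suc n) = begin
  length (ordinaryTriples (4 + n) ++ map (λ (a , b) → a , b , 4 + n) (ordinaryPairs (4 + n))) + (5 + n)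
    ≡⟨ cong (_+ (5 + n)) (length-++-map (ordinaryTriples (4 + n)) _ (ordinaryPairs (4 + n))) ⟩
  length (ordinaryTriples (4 + n)) + length (ordinaryPairs (4 + n)) + (5 + n)
    ≡⟨ rearrange (length (ordinaryTriples (4 + n))) (length (ordinaryPairs (4 + n))) (4 + n) ⟩
  (length (ordinaryPairs (4 + n)) + 1) + (length (ordinaryTriples (4 + n)) + (4 + n))
    ≡⟨ cong₂ _+_ (length-ordinaryPairs (2 + n)) (length-ordinaryTriples n) ⟩
  (4 + n) C 2 + (4 + n) C 3
    ≡⟨ nCk+nC[k+1]≡[n+1]C[k+1] (4 + n) 2 ⟩
  (5 + n) C 3 ∎
  where
  open ≡-Reasoning
  rearrange : ∀ t p k → t + p + suc k ≡ (p + 1) + (t + k)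
  rearrange = solve-∀

-- The special triples, one through each x < l, are exactly the sorted triples below l that are
-- not ordinary, which is why the two kinds together number l C 3.
specialTriple : ℕ → ℕ × ℕ × ℕ
specialTriple 0 = 0 , 2 , 3
specialTriple 1 = 1 , 2 , 3
specialTriple x@(suc (suc _)) = 0 , 1 , x

SortedBelow : ℕ → ℕ × ℕ × ℕ → Set
SortedBelow l (a , b , c) = a < b × b < c × c < l

specialTriple-sortedBelow : ∀ {l x} → 4 ≤ l → x < l → SortedBelow l (specialTriple x)
specialTriple-sortedBelow {x = 0} 4≤l _ = s≤s z≤n , s≤s (s≤s (s≤s z≤n)) , 4≤l
specialTriple-sortedBelow {x = 1} 4≤l _ = s≤s (s≤s z≤n) , s≤s (s≤s (s≤s z≤n)) , 4≤l
specialTriple-sortedBelow {x = suc (suc _)} _ x<l = s≤s z≤n , s≤s (s≤s z≤n) , x<l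

specialTriple-self : ∀ x → x ∈₃ specialTriple x
specialTriple-self 0 = inj₁ refl
specialTriple-self 1 = inj₁ refl
specialTriple-self (suc (suc _)) = inj₂ (inj₂ refl)

specialTriple-injective : ∀ {x y} → specialTriple x ≡ specialTriple y → x ≡ y
specialTriple-injective {0} {0} _ = refl
specialTriple-injective {1} {1} _ = refl
specialTriple-injective {suc (suc _)} {suc (suc _)} refl = refl
specialTriple-injective {0} {1} ()
specialTriple-injective {1} {0} ()

specialTriple-not-ordinary : ∀ {l t} x → OrdinaryTriple l t → specialTriple x ≢ t
specialTriple-not-ordinary 0 (_ , _ , _ , 4≤3 , _) refl = contradiction 4≤3 λ { (s≤s (s≤s (s≤s ()))) }
specialTriple-not-ordinary 1 (_ , _ , _ , 4≤3 , _) refl = contradiction 4≤3 λ { (s≤s (s≤s (s≤s ()))) }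
specialTriple-not-ordinary (suc (suc _)) (_ , 2≤1 , _) refl = contradiction 2≤1 λ { (s≤s ()) }

lookup-injective : ∀ {A : Set} {xs : List A} → Unique xs → ∀ {i j} → lookup xs i ≡ lookup xs j → i ≡ j
lookup-injective {xs = _ ∷ _} _ {Fin.zero} {Fin.zero} _ = refl
lookup-injective {xs = _ ∷ _} (x∉ ∷ _) {Fin.zero} {Fin.suc j} eq = contradiction eq (All.lookup x∉ (∈-lookup j))
lookup-injective {xs = _ ∷ _} (x∉ ∷ _) {Fin.suc i} {Fin.zero} eq = contradiction (sym eq) (All.lookup x∉ (∈-lookup i))
lookup-injective {xs = _ ∷ _} (_ ∷ xs-unique) {Fin.suc i} {Fin.suc j} eq = cong Fin.suc (lookup-injective xs-unique eq)

sorted⇒distinct : ∀ {t} → Sorted t → Distinct₃ t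
sorted⇒distinct (a<b , b<c) = <⇒≢ a<b , <⇒≢ (<-trans a<b b<c) , <⇒≢ b<c

sortedBelow-mono : ∀ {l v t} → l ≤ v → SortedBelow l t → SortedBelow v t
sortedBelow-mono l≤v (a<b , b<c , c<l) = a<b , b<c , <-≤-trans c<l l≤v

fromℕ<₃ : ∀ {v t} → SortedBelow v t → Fin v × Fin v × Fin v
fromℕ<₃ (a<b , b<c , c<v) = fromℕ< (<-trans a<b (<-trans b<c c<v)) , fromℕ< (<-trans b<c c<v) , fromℕ< c<v

toℕ-fromℕ<₃ : ∀ {v t} (t<v : SortedBelow v t) → map₃ toℕ (fromℕ<₃ t<v) ≡ t
toℕ-fromℕ<₃ _ = cong₂ _,_ (toℕ-fromℕ< _) (cong₂ _,_ (toℕ-fromℕ< _) (toℕ-fromℕ< _))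

record BlockSystem (v l : ℕ) : Set where
  field
    block          : Fin v → Fin v × Fin v × Fin v
    block-distinct : ∀ x → Distinct₃ (block x)
    block-bounded  : ∀ {x z} → z ∈₃ block x → toℕ z < l
    block-self     : ∀ {x} → toℕ x < l → x ∈₃ block x
    block-sharing  : ∀ {w x y} → Distinct₃ w → w ⊆₃ block x → w ⊆₃ block y → x ≡ y

l+ordinaryTriples≡lC3 : ∀ {l} → 4 ≤ l → l + length (ordinaryTriples l) ≡ l C 3
l+ordinaryTriples≡lC3 {suc (suc (suc (suc n)))} (s≤s (s≤s (s≤s (s≤s _)))) =
  trans (+-comm (4 + n) _) (length-ordinaryTriples n)

module _ {v l : ℕ} (4≤l : 4 ≤ l) (l≤v : l ≤ v) (v≤lC3 : v ≤ l C 3) where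

  private
    v≤ : v ≤ l + length (ordinaryTriples l)
    v≤ = subst (v ≤_) (sym (l+ordinaryTriples≡lC3 4≤l)) v≤lC3

    Slot : Set
    Slot = Fin l ⊎ Fin (length (ordinaryTriples l))

    slotTriple : Slot → ℕ × ℕ × ℕ
    slotTriple (inj₁ x) = specialTriple (toℕ x)
    slotTriple (inj₂ k) = lookup (ordinaryTriples l) k

    slotTriple-sortedBelow : ∀ i → SortedBelow l (slotTriple i)
    slotTriple-sortedBelow (inj₁ x) = specialTriple-sortedBelow 4≤l (toℕ<n x)
    slotTriple-sortedBelow (inj₂ k)
      with a<b , _ , b<c , _ , c<l ← All.lookup (ordinaryTriples-all l) (∈-lookup k) = a<b , b<c , c<l

    slotTriple-injective : ∀ {i j} → slotTriple i ≡ slotTriple j → i ≡ j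
    slotTriple-injective {inj₁ x} {inj₁ y} eq = cong inj₁ (toℕ-injective (specialTriple-injective eq))
    slotTriple-injective {inj₁ x} {inj₂ k} eq =
      contradiction eq (specialTriple-not-ordinary _ (All.lookup (ordinaryTriples-all l) (∈-lookup k)))
    slotTriple-injective {inj₂ k} {inj₁ y} eq =
      contradiction (sym eq) (specialTriple-not-ordinary _ (All.lookup (ordinaryTriples-all l) (∈-lookup k)))
    slotTriple-injective {inj₂ k} {inj₂ k′} eq = cong inj₂ (lookup-injective (ordinaryTriples-unique l) eq)

    slot : Fin v → Slot
    slot x = splitAt l (inject≤ x v≤)

    slot-injective : ∀ {x y} → slot x ≡ slot y → x ≡ y
    slot-injective {x} {y} eq = toℕ-injective (begin
      toℕ x                                     ≡⟨ toℕ-inject≤ x v≤ ⟨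
      toℕ (inject≤ x v≤)                        ≡⟨ cong toℕ (join-splitAt l _ (inject≤ x v≤)) ⟨
      toℕ (join l _ (slot x))                   ≡⟨ cong (toℕ ∘ join l _) eq ⟩
      toℕ (join l _ (slot y))                   ≡⟨ cong toℕ (join-splitAt l _ (inject≤ y v≤)) ⟩
      toℕ (inject≤ y v≤)                        ≡⟨ toℕ-inject≤ y v≤ ⟩
      toℕ y                                     ∎)
      where open ≡-Reasoning

    triple : Fin v → ℕ × ℕ × ℕ
    triple x = slotTriple (slot x)

    triple-sortedBelow : ∀ x → SortedBelow l (triple x)
    triple-sortedBelow x = slotTriple-sortedBelow (slot x)

    triple-special : ∀ {x} → toℕ x < l → triple x ≡ specialTriple (toℕ x)
    triple-special {x} x<l = begin
      slotTriple (splitAt l (inject≤ x v≤))  ≡⟨ cong slotTriple (splitAt-< l (inject≤ x v≤) x′<l) ⟩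
      specialTriple (toℕ (fromℕ< x′<l))      ≡⟨ cong specialTriple (trans (toℕ-fromℕ< x′<l) (toℕ-inject≤ x v≤)) ⟩
      specialTriple (toℕ x)                  ∎
      where
      open ≡-Reasoning
      x′<l : toℕ (inject≤ x v≤) < l
      x′<l = subst (_< l) (sym (toℕ-inject≤ x v≤)) x<l

    block : Fin v → Fin v × Fin v × Fin v
    block x = fromℕ<₃ (sortedBelow-mono l≤v (triple-sortedBelow x))

    toℕ-block : ∀ x → map₃ toℕ (block x) ≡ triple x
    toℕ-block x = toℕ-fromℕ<₃ (sortedBelow-mono l≤v (triple-sortedBelow x))

    toℕ-∈₃-block : ∀ {x z} → z ∈₃ block x → toℕ z ∈₃ triple x
    toℕ-∈₃-block {x} z∈ = subst (_ ∈₃_) (toℕ-block x) (∈₃-map⁺ toℕ z∈)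

    toℕ-⊆₃-block : ∀ {w x} → w ⊆₃ block x → map₃ toℕ w ⊆₃ triple x
    toℕ-⊆₃-block w⊆x = ⊆₃-intro (toℕ-∈₃-block (w⊆x (inj₁ refl))) (toℕ-∈₃-block (w⊆x (inj₂ (inj₁ refl))))
                                 (toℕ-∈₃-block (w⊆x (inj₂ (inj₂ refl))))

    sorted-triple : ∀ x → Sorted (triple x)
    sorted-triple x with a<b , b<c , _ ← triple-sortedBelow x = a<b , b<c

  blockSystem : BlockSystem v l
  blockSystem = record
    { block          = block
    ; block-distinct = λ x → distinct-map⁻ toℕ (subst Distinct₃ (sym (toℕ-block x)) (sorted⇒distinct (sorted-triple x)))
    ; block-bounded  = λ {x} z∈ → ≤-<-trans (proj₂ (sorted-bounds (sorted-triple x) (toℕ-∈₃-block z∈)))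
                                            (proj₂ (proj₂ (triple-sortedBelow x)))
    ; block-self     = λ {x} x<l → ∈₃-map⁻ toℕ toℕ-injective
                         (subst (toℕ x ∈₃_) (sym (trans (toℕ-block x) (triple-special x<l))) (specialTriple-self (toℕ x)))
    ; block-sharing  = λ {w} {x} {y} w-distinct w⊆x w⊆y → slot-injective (slotTriple-injective
                         (sorted-determined-by-three (sorted-triple x) (sorted-triple y)
                           (distinct-map⁺ toℕ toℕ-injective w-distinct)
                           (toℕ-⊆₃-block w⊆x) (toℕ-⊆₃-block w⊆y)))
    }

module _ {N v : ℕ} (rows : Array N v) where

  Leads : Fin N → Fin v → List (Sym N v) → Set
  Leads i a S = ∀ z → inj₁ z ∈ S → z ≢ a → toℕ (rows i ⟨$⟩ˡ a) < toℕ (rows i ⟨$⟩ˡ z)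

  module _ (A : AppendOrder N) where

    pos-own : ∀ i → pos rows A i (inj₂ i) ≡ 0
    pos-own i with i Fin.≟ i
    ... | yes _ = refl
    ... | no i≢i = contradiction refl i≢i

    pos-other : ∀ {i k} → i ≢ k → v < pos rows A i (inj₂ k)
    pos-other {i} {k} i≢k with i Fin.≟ k
    ... | yes i≡k = contradiction i≡k i≢k
    ... | no _ = s≤s (m≤m+n v _)

  suitableCore-fromLeaders : ∀ t →
    (∀ a (S : List (Sym N v)) → length S ≡ t → inj₁ a ∈ S → ∃ λ i → inj₂ i ∉ S × Leads i a S) →
    SuitableCore N v t rows
  suitableCore-fromLeaders t leaders A S _ _ (inj₂ k) _ = k , λ
    { (inj₁ z) _ _ → subst (_< pos rows A k (inj₁ z)) (sym (pos-own A k)) (s≤s z≤n)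
    ; (inj₂ k′) _ k′≢k → subst (_< pos rows A k (inj₂ k′)) (sym (pos-own A k))
                                (≤-<-trans z≤n (pos-other A (k′≢k ∘ cong inj₂ ∘ sym)))
    }
  suitableCore-fromLeaders t leaders A S _ |S|≡t (inj₁ a) a∈S with leaders a S |S|≡t a∈S
  ... | i , i∉S , a-leads = i , λ
    { (inj₁ z) z∈S z≢a → s≤s (a-leads z z∈S (z≢a ∘ cong inj₁))
    ; (inj₂ k) k∈S _ → ≤-<-trans (toℕ<n (rows i ⟨$⟩ˡ a)) (pos-other A λ { refl → i∉S k∈S })
    }

module Construction (m l : ℕ) (l≤v : l ≤ 4 + m) (blocks : BlockSystem (4 + m) l) where

  open BlockSystem blocks

  v : ℕ
  v = 4 + m

  _∈ᵇ?_ : ∀ z x → Dec (z ∈₃ block x)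
  z ∈ᵇ? x = ∈₃-dec Fin._≟_ z (block x)

  corner₀ corner₁ corner₂ : Fin v → Fin v
  corner₀ x = proj₁ (block x)
  corner₁ x = proj₁ (proj₂ (block x))
  corner₂ x = proj₂ (proj₂ (block x))

  cornerPlaces : Fin v → List (Fin v × Fin v)
  cornerPlaces x = (corner₀ x , # 0) ∷ (corner₁ x , # 1) ∷ (corner₂ x , # 2) ∷ []

  LaysOut : Permutation′ v → Fin v → Set
  LaysOut π x = All (Sends π) (cornerPlaces x) × (¬ toℕ x < l → Sends π (x , # 3))

  corners-unique : ∀ x → Unique (map proj₁ (cornerPlaces x))
  corners-unique x with c₀≢c₁ , c₀≢c₂ , c₁≢c₂ ← block-distinct x =
    (c₀≢c₁ ∷ c₀≢c₂ ∷ []) ∷ (c₁≢c₂ ∷ []) ∷ [] ∷ []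

  corners-self-unique : ∀ x → ¬ toℕ x < l → Unique (map proj₁ (cornerPlaces x ++ (x , # 3) ∷ []))
  corners-self-unique x x≮l with c₀≢c₁ , c₀≢c₂ , c₁≢c₂ ← block-distinct x =
    (c₀≢c₁ ∷ c₀≢c₂ ∷ c≢x (inj₁ refl) ∷ []) ∷ (c₁≢c₂ ∷ c≢x (inj₂ (inj₁ refl)) ∷ [])
      ∷ (c≢x (inj₂ (inj₂ refl)) ∷ []) ∷ [] ∷ []
    where
    c≢x : ∀ {c} → c ∈₃ block x → c ≢ x
    c≢x c∈x refl = x≮l (block-bounded c∈x)

  arrangeLayout : ∀ x → Dec (toℕ x < l) → Σ[ π ∈ Permutation′ v ] LaysOut π x
  arrangeLayout x (yes x<l) with π , sends ← arrange (cornerPlaces x) (corners-unique x)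
      (((λ ()) ∷ (λ ()) ∷ []) ∷ ((λ ()) ∷ []) ∷ [] ∷ [])
    = π , sends , contradiction x<l
  arrangeLayout x (no x≮l) with π , s₀ ∷ s₁ ∷ s₂ ∷ s₃ ∷ [] ← arrange (cornerPlaces x ++ (x , # 3) ∷ [])
      (corners-self-unique x x≮l)
      (((λ ()) ∷ (λ ()) ∷ (λ ()) ∷ []) ∷ ((λ ()) ∷ (λ ()) ∷ []) ∷ ((λ ()) ∷ []) ∷ [] ∷ [])
    = π , (s₀ ∷ s₁ ∷ s₂ ∷ []) , λ _ → s₃

  -- Outside B(x) ∪ {x} the layout only uses the positions 4, 5, …, and 3 as well if x < l.
  layout : Fin v → Permutation′ v
  layout x = proj₁ (arrangeLayout x (toℕ x <? l))

  layout-laysOut : ∀ x → LaysOut (layout x) x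
  layout-laysOut x = proj₂ (arrangeLayout x (toℕ x <? l))

  -- The row (x , k) is led by x, and its partner is the symbol at position 4 + k of layout x;
  -- the extra row of x < l takes position 3.
  Row : Set
  Row = Fin v × Fin m ⊎ Fin l

  leader : Row → Fin v
  leader (inj₁ (x , _)) = x
  leader (inj₂ j) = inject≤ j l≤v

  slot : Row → Fin v
  slot (inj₁ (_ , k)) = Fin.suc (Fin.suc (Fin.suc (Fin.suc k)))
  slot (inj₂ _) = # 3

  partner : Row → Fin v
  partner r = layout (leader r) ⟨$⟩ˡ slot r

  partner-via : ∀ {r x y} → leader r ≡ x → layout x ⟨$⟩ʳ y ≡ slot r → partner r ≡ y
  partner-via refl y↦ = trans (cong (layout _ ⟨$⟩ˡ_) (sym y↦)) (inverseˡ (layout _))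

  partner-onto : ∀ {x y} → y ≢ x → ¬ y ∈₃ block x → ∃ λ r → leader r ≡ x × partner r ≡ y
  partner-onto {x} {y} y≢x y∉x with layout-laysOut x | layout x ⟨$⟩ʳ y in y↦
  ... | s₀ ∷ _ , _ | Fin.zero =
    contradiction (inj₁ (⟨$⟩ʳ-injective (layout x) (trans y↦ (sym s₀)))) y∉x
  ... | _ ∷ s₁ ∷ _ , _ | Fin.suc Fin.zero =
    contradiction (inj₂ (inj₁ (⟨$⟩ʳ-injective (layout x) (trans y↦ (sym s₁))))) y∉x
  ... | _ ∷ _ ∷ s₂ ∷ _ , _ | Fin.suc (Fin.suc Fin.zero) =
    contradiction (inj₂ (inj₂ (⟨$⟩ʳ-injective (layout x) (trans y↦ (sym s₂))))) y∉x
  ... | _ , x↦3 | Fin.suc (Fin.suc (Fin.suc Fin.zero)) = case toℕ x <? l of λ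
    { (yes x<l) → let leader≡x = toℕ-injective (trans (toℕ-inject≤ _ l≤v) (toℕ-fromℕ< x<l))
                  in inj₂ (fromℕ< x<l) , leader≡x , partner-via {inj₂ (fromℕ< x<l)} leader≡x y↦
    ; (no x≮l) → contradiction (⟨$⟩ʳ-injective (layout x) (trans y↦ (sym (x↦3 x≮l)))) y≢x
    }
  ... | _ | Fin.suc (Fin.suc (Fin.suc (Fin.suc k))) =
    inj₁ (x , k) , refl , partner-via {inj₁ (x , k)} refl y↦

  Common : Fin v → Fin v → Fin v → Set
  Common x y z = z ∈₃ block x × z ∈₃ block y

  Shared : Fin v → Fin v → Fin v → Set
  Shared x y z = Common x y z × z ≢ x × z ≢ y

  shared? : ∀ x y z → Dec (Shared x y z)
  shared? x y z = (z ∈ᵇ? x ×-dec z ∈ᵇ? y) ×-dec ¬? (z Fin.≟ x) ×-dec ¬? (z Fin.≟ y)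

  firstShared : Fin v → Fin v → Fin v
  firstShared x y = choose (shared? x y) x

  otherShared? : ∀ x y z → Dec (Shared x y z × z ≢ firstShared x y)
  otherShared? x y z = shared? x y z ×-dec ¬? (z Fin.≟ firstShared x y)

  secondShared : Fin v → Fin v → Fin v
  secondShared x y = choose (otherShared? x y) (firstShared x y)

  third : Fin v → Fin v → Fin v
  third x y with toℕ x <? toℕ y
  ... | yes _ = firstShared x y
  ... | no _ = secondShared y x

  third-< : ∀ {x y} → toℕ x < toℕ y → third x y ≡ firstShared x y
  third-< {x} {y} x<y with toℕ x <? toℕ y
  ... | yes _ = refl
  ... | no x≮y = contradiction x<y x≮y

  third-> : ∀ {x y} → toℕ x < toℕ y → third y x ≡ secondShared x y
  third-> {x} {y} x<y with toℕ y <? toℕ x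
  ... | yes y<x = contradiction y<x (<-asym x<y)
  ... | no _ = refl

  firstShared-shared : ∀ {x y} → ∃ (Shared x y) → Shared x y (firstShared x y)
  firstShared-shared {x} {y} = choose-spec (shared? x y) x

  secondShared-shared : ∀ {x y} → ∃ (Shared x y) → Shared x y (secondShared x y)
  secondShared-shared {x} {y} some with choose-default (otherShared? x y) (firstShared x y)
  ... | inj₁ (shared , _) = shared
  ... | inj₂ default = subst (Shared x y) (sym default) (firstShared-shared some)

  secondShared-≢ : ∀ {x y} → (∃ λ z → Shared x y z × z ≢ firstShared x y) → secondShared x y ≢ firstShared x y
  secondShared-≢ {x} {y} other = proj₂ (choose-spec (otherShared? x y) _ other)

  RowShape : Fin v → Fin v → Fin v → Permutation′ v → Set
  RowShape x y c π = Sends π (x , # 0) × (y ≢ x → Sends π (y , # 1)) × (Distinct₃ (x , y , c) → Sends π (c , # 2))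

  arrangeRow : ∀ x y c → Dec (y ≡ x) → Dec (Distinct₃ (x , y , c)) → Σ[ π ∈ Permutation′ v ] RowShape x y c π
  arrangeRow x y c _ (yes (x≢y , x≢c , y≢c))
    with π , s₀ ∷ s₁ ∷ s₂ ∷ [] ← arrange ((x , # 0) ∷ (y , # 1) ∷ (c , # 2) ∷ [])
           ((x≢y ∷ x≢c ∷ []) ∷ (y≢c ∷ []) ∷ [] ∷ []) (((λ ()) ∷ (λ ()) ∷ []) ∷ ((λ ()) ∷ []) ∷ [] ∷ [])
    = π , s₀ , (λ _ → s₁) , λ _ → s₂
  arrangeRow x y c (no y≢x) (no ¬distinct)
    with π , s₀ ∷ s₁ ∷ [] ← arrange ((x , # 0) ∷ (y , # 1) ∷ [])
           (((y≢x ∘ sym) ∷ []) ∷ [] ∷ []) (((λ ()) ∷ []) ∷ [] ∷ [])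
    = π , s₀ , (λ _ → s₁) , λ d → contradiction d ¬distinct
  arrangeRow x y c (yes y≡x) (no ¬distinct) with π , s₀ ∷ [] ← arrange ((x , # 0) ∷ []) ([] ∷ []) ([] ∷ [])
    = π , s₀ , (λ y≢x → contradiction y≡x y≢x) , λ d → contradiction d ¬distinct

  rowArrangement : ∀ r → Σ[ π ∈ Permutation′ v ] RowShape (leader r) (partner r) (third (leader r) (partner r)) π
  rowArrangement r = arrangeRow _ _ _ (partner r Fin.≟ leader r) (distinct₃? Fin._≟_ _)

  opaque
    rowPermutation : Row → Permutation′ v
    rowPermutation r = proj₁ (rowArrangement r)

    rowPermutation-shape : ∀ r → RowShape (leader r) (partner r) (third (leader r) (partner r)) (rowPermutation r)
    rowPermutation-shape r = proj₂ (rowArrangement r)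

  N : ℕ
  N = v * m + l

  opaque
    encode : Row → Fin N
    encode (inj₁ (x , k)) = join (v * m) l (inj₁ (combine x k))
    encode (inj₂ j) = join (v * m) l (inj₂ j)

    decode : Fin N → Row
    decode i = Sum.map₁ (remQuot m) (splitAt (v * m) i)

    decode-encode : ∀ r → decode (encode r) ≡ r
    decode-encode (inj₁ (x , k)) =
      trans (cong (Sum.map₁ (remQuot m)) (splitAt-join (v * m) l (inj₁ (combine x k))))
            (cong inj₁ (remQuot-combine x k))
    decode-encode (inj₂ j) = cong (Sum.map₁ (remQuot m)) (splitAt-join (v * m) l (inj₂ j))

  rows : Array N v
  rows i = flip (rowPermutation (decode i))

  RowLeads : Row → Fin v → List (Sym N v) → Set
  RowLeads r a S = ∀ z → inj₁ z ∈ S → z ≢ a → toℕ (rowPermutation r ⟨$⟩ʳ a) < toℕ (rowPermutation r ⟨$⟩ʳ z)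

  leads-encode : ∀ {r a S} → RowLeads r a S → Leads rows (encode r) a S
  leads-encode {r} {a} {S} = subst (λ r′ → RowLeads r′ a S) (sym (decode-encode r))

  module _ (r : Row) {a : Fin v} {S : List (Sym N v)} where

    private
      π = rowPermutation r
      x = leader r
      y = partner r
      c = third x y

      x↦0 : π ⟨$⟩ʳ x ≡ # 0
      x↦0 = proj₁ (rowPermutation-shape r)

      earlier : ∀ {z w k} → π ⟨$⟩ʳ w ≡ k → toℕ (π ⟨$⟩ʳ z) < toℕ (π ⟨$⟩ʳ w) → toℕ (π ⟨$⟩ʳ z) < toℕ k
      earlier w↦k = subst (λ q → _ < toℕ q) w↦k

      before-second : ∀ {z} → toℕ (π ⟨$⟩ʳ z) < 1 → z ≡ x
      before-second z<1 = ⟨$⟩ʳ-injective π (trans (toℕ<1 z<1) (sym x↦0))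

      before-third : ∀ {z} → y ≢ x → toℕ (π ⟨$⟩ʳ z) < 2 → z ≡ x ⊎ z ≡ y
      before-third y≢x z<2 with toℕ<2 z<2
      ... | inj₁ z↦0 = inj₁ (⟨$⟩ʳ-injective π (trans z↦0 (sym x↦0)))
      ... | inj₂ z↦1 = inj₂ (⟨$⟩ʳ-injective π (trans z↦1 (sym (proj₁ (proj₂ (rowPermutation-shape r)) y≢x))))

    leads-as-leader : x ≡ a → RowLeads r a S
    leads-as-leader refl = precedes-if-earlier-absent π λ z z<a → contradiction (earlier x↦0 z<a) λ ()

    leads-as-partner : y ≡ a → x ≢ a → inj₁ x ∉ S → RowLeads r a S
    leads-as-partner refl x≢y x∉S = precedes-if-earlier-absent π λ z z<y →
      subst (λ w → inj₁ w ∉ S) (sym (before-second (earlier y↦1 z<y))) x∉S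
      where y↦1 = proj₁ (proj₂ (rowPermutation-shape r)) (x≢y ∘ sym)

    leads-as-third : c ≡ a → Distinct₃ (x , y , c) → inj₁ x ∉ S → inj₁ y ∉ S → RowLeads r a S
    leads-as-third refl distinct x∉S y∉S = precedes-if-earlier-absent π λ z z<c →
      case before-third (proj₁ distinct ∘ sym) (earlier (proj₂ (proj₂ (rowPermutation-shape r)) distinct) z<c) of λ
      { (inj₁ refl) → x∉S ; (inj₂ refl) → y∉S }

  no-three-common : ∀ {x y p q z} → x ≢ y → Distinct₃ (p , q , z) → Common x y p → Common x y q → Common x y z → ⊥
  no-three-common x≢y distinct (p∈x , p∈y) (q∈x , q∈y) (z∈x , z∈y) =
    x≢y (block-sharing distinct (⊆₃-intro p∈x q∈x z∈x) (⊆₃-intro p∈y q∈y z∈y))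

  common-self : ∀ {x y} → y ∈₃ block x → Common x y y
  common-self y∈x = y∈x , block-self (block-bounded y∈x)

  common-swap : ∀ {x y z} → Common x y z → Common y x z
  common-swap (z∈x , z∈y) = z∈y , z∈x

  PairRow : Fin v → Fin v → Fin v → Set
  PairRow x y c = ∃ λ r → (leader r ≡ x × partner r ≡ y ⊎ leader r ≡ y × partner r ≡ x)
                        × third (leader r) (partner r) ≡ c

  pairRow-swap : ∀ {x y c} → PairRow x y c → PairRow y x c
  pairRow-swap (r , ends , r↦c) = r , Sum.swap ends , r↦c

  directed-pairRow : ∀ {x y c} → y ≢ x → ¬ y ∈₃ block x → third x y ≡ c → PairRow x y c
  directed-pairRow y≢x y∉x xy↦c with r , refl , refl ← partner-onto y≢x y∉x = r , inj₁ (refl , refl) , xy↦c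

  -- The row (x, y) exists unless y ∈ B(x), the row (y, x) unless x ∈ B(y); whenever neither
  -- available row has third symbol c, three distinct symbols would lie in B(x) ∩ B(y).
  pairRow-< : ∀ {x y c} → toℕ x < toℕ y → Shared x y c → PairRow x y c
  pairRow-< {x} {y} {c} x<y c-shared@(c-common , c≢x , c≢y) =
    cases (y ∈ᵇ? x) (x ∈ᵇ? y) (firstShared x y Fin.≟ c) (secondShared x y Fin.≟ c)
    where
    x≢y : x ≢ y
    x≢y = toℕ<⇒≢ x<y
    A-shared : Shared x y (firstShared x y)
    A-shared = firstShared-shared (c , c-shared)
    B-shared : Shared x y (secondShared x y)
    B-shared = secondShared-shared (c , c-shared)
    cases : Dec (y ∈₃ block x) → Dec (x ∈₃ block y) → Dec (firstShared x y ≡ c) → Dec (secondShared x y ≡ c) →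
      PairRow x y c
    cases (no y∉x) _ (yes A≡c) _ = directed-pairRow (x≢y ∘ sym) y∉x (trans (third-< x<y) A≡c)
    cases _ (no x∉y) _ (yes B≡c) = pairRow-swap (directed-pairRow x≢y x∉y (trans (third-> x<y) B≡c))
    cases (no _) (no _) (no A≢c) (no B≢c) = ⊥-elim (no-three-common x≢y
      ((A≢c ∘ sym) , (B≢c ∘ sym) , secondShared-≢ (c , c-shared , A≢c ∘ sym) ∘ sym)
      c-common (proj₁ A-shared) (proj₁ B-shared))
    cases (no _) (yes x∈y) (no A≢c) _ = ⊥-elim (no-three-common x≢y
      (proj₁ (proj₂ A-shared) ∘ sym , c≢x ∘ sym , A≢c)
      (common-swap (common-self x∈y)) (proj₁ A-shared) c-common)
    cases (yes y∈x) (no _) _ (no B≢c) = ⊥-elim (no-three-common x≢y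
      (proj₂ (proj₂ B-shared) ∘ sym , c≢y ∘ sym , B≢c)
      (common-self y∈x) (proj₁ B-shared) c-common)
    cases (yes y∈x) (yes x∈y) _ _ = ⊥-elim (no-three-common x≢y
      (x≢y , c≢x ∘ sym , c≢y ∘ sym)
      (common-swap (common-self x∈y)) (common-self y∈x) c-common)

  pairRow : ∀ {x y c} → x ≢ y → Shared x y c → PairRow x y c
  pairRow {x} {y} x≢y c-shared@(c-common , c≢x , c≢y) with <-cmp (toℕ x) (toℕ y)
  ... | tri< x<y _ _ = pairRow-< x<y c-shared
  ... | tri≈ _ x≡y _ = contradiction (toℕ-injective x≡y) x≢y
  ... | tri> _ _ y<x = pairRow-swap (pairRow-< y<x (common-swap c-common , c≢y , c≢x))

  symbol-≟ : DecidableEquality (Sym N v)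
  symbol-≟ = ≡-dec Fin._≟_ Fin._≟_

  module Certificates (a : Fin v) (S : List (Sym N v)) (a∈S : inj₁ a ∈ S) where

    open DecMembership symbol-≟ using (_∈?_)

    a≢outside : ∀ {z} → inj₁ z ∉ S → a ≢ z
    a≢outside z∉S refl = z∉S a∈S

    outsider : Fin v
    outsider = choose (λ z → a ∈ᵇ? z ×-dec ¬? (inj₁ z ∈? S)) a

    outsider-spec : ∀ {y} → a ∈₃ block y → inj₁ y ∉ S → a ∈₃ block outsider × inj₁ outsider ∉ S
    outsider-spec a∈y y∉S = choose-spec (λ z → a ∈ᵇ? z ×-dec ¬? (inj₁ z ∈? S)) a (_ , a∈y , y∉S)

    Label : Set
    Label = Fin v ⊎ Fin m

    counterpart : Fin v → Fin v → Fin v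
    counterpart x y with y Fin.≟ a | x Fin.≟ outsider
    ... | yes _ | _ = x
    ... | no _ | yes _ = y
    ... | no _ | no _ = x

    ownLabel : Row → Label
    ownLabel (inj₁ (_ , k)) = inj₂ k
    ownLabel (inj₂ _) = inj₁ outsider

    rowLabel : Row → Label
    rowLabel r with leader r Fin.≟ a
    ... | yes _ = ownLabel r
    ... | no _ = inj₁ (counterpart (leader r) (partner r))

    -- A left inverse of the certificates below, which keeps certificates of distinct labels apart.
    label : Sym N v → Label
    label (inj₁ y) = inj₁ y
    label (inj₂ i) = rowLabel (decode i)

    Certificate : Label → Set
    Certificate j = Σ[ σ ∈ Sym N v ] (σ ∈ S ⊎ ∃ λ r → σ ≡ inj₂ (encode r) × RowLeads r a S) × label σ ≡ j

    certify : ∀ {j} r → RowLeads r a S → rowLabel r ≡ j → Certificate j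
    certify r r-leads r↦j = inj₂ (encode r) , inj₂ (r , refl , r-leads) , trans (cong rowLabel (decode-encode r)) r↦j

    rowLabel-own : ∀ r → leader r ≡ a → rowLabel r ≡ ownLabel r
    rowLabel-own r leader≡a with leader r Fin.≟ a
    ... | yes _ = refl
    ... | no leader≢a = contradiction leader≡a leader≢a

    rowLabel-other : ∀ r → leader r ≢ a → rowLabel r ≡ inj₁ (counterpart (leader r) (partner r))
    rowLabel-other r leader≢a with leader r Fin.≟ a
    ... | yes leader≡a = contradiction leader≡a leader≢a
    ... | no _ = refl

    counterpart-of-a : ∀ {x y} → y ≡ a → counterpart x y ≡ x
    counterpart-of-a {x} {y} y≡a with y Fin.≟ a
    ... | yes _ = refl
    ... | no y≢a = contradiction y≡a y≢a

    counterpart-of-outsider : ∀ {x y} → y ≢ a → x ≡ outsider → counterpart x y ≡ y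
    counterpart-of-outsider {x} {y} y≢a x≡μ with y Fin.≟ a | x Fin.≟ outsider
    ... | yes y≡a | _ = contradiction y≡a y≢a
    ... | no _ | yes _ = refl
    ... | no _ | no x≢μ = contradiction x≡μ x≢μ

    counterpart-of-other : ∀ {x y} → y ≢ a → x ≢ outsider → counterpart x y ≡ x
    counterpart-of-other {x} {y} y≢a x≢μ with y Fin.≟ a | x Fin.≟ outsider
    ... | yes y≡a | _ = contradiction y≡a y≢a
    ... | no _ | yes x≡μ = contradiction x≡μ x≢μ
    ... | no _ | no _ = refl

    certificate-with-a : ∀ k → Certificate (inj₂ k)
    certificate-with-a k = certify (inj₁ (a , k)) (leads-as-leader (inj₁ (a , k)) refl) (rowLabel-own (inj₁ (a , k)) refl)

    certificate-facing-a : ∀ {y} → inj₁ y ∉ S → ¬ a ∈₃ block y → Certificate (inj₁ y)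
    certificate-facing-a y∉S a∉y with r , refl , partner≡a ← partner-onto (a≢outside y∉S) a∉y =
      certify r (leads-as-partner r partner≡a leader≢a y∉S)
                (trans (rowLabel-other r leader≢a) (cong inj₁ (counterpart-of-a partner≡a)))
      where leader≢a = a≢outside y∉S ∘ sym

    certificate-outsider : ∀ {y} → a ∈₃ block y → y ≡ outsider → Certificate (inj₁ y)
    certificate-outsider a∈y y≡μ =
      certify (inj₂ (fromℕ< a<l)) (leads-as-leader (inj₂ (fromℕ< a<l)) leader≡a)
              (trans (rowLabel-own (inj₂ (fromℕ< a<l)) leader≡a) (cong inj₁ (sym y≡μ)))
      where
      a<l = block-bounded a∈y
      leader≡a : inject≤ (fromℕ< a<l) l≤v ≡ a
      leader≡a = toℕ-injective (trans (toℕ-inject≤ _ l≤v) (toℕ-fromℕ< a<l))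

    certify-pair : ∀ {y} r → third (leader r) (partner r) ≡ a → leader r ≢ partner r →
      inj₁ (leader r) ∉ S → inj₁ (partner r) ∉ S → counterpart (leader r) (partner r) ≡ y → Certificate (inj₁ y)
    certify-pair r third≡a leader≢partner leader∉S partner∉S counterpart≡y =
      certify r (leads-as-third r third≡a distinct leader∉S partner∉S)
                (trans (rowLabel-other r (a≢outside leader∉S ∘ sym)) (cong inj₁ counterpart≡y))
      where
      distinct = leader≢partner
               , (λ eq → a≢outside leader∉S (sym (trans eq third≡a)))
               , (λ eq → a≢outside partner∉S (sym (trans eq third≡a)))

    certificate-with-outsider : ∀ {y} → inj₁ y ∉ S → a ∈₃ block y → y ≢ outsider → Certificate (inj₁ y)
    certificate-with-outsider {y} y∉S a∈y y≢μ =
      from-pairRow (pairRow y≢μ ((a∈y , a∈μ) , a≢outside y∉S , a≢outside μ∉S))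
      where
      a∈μ = proj₁ (outsider-spec a∈y y∉S)
      μ∉S = proj₂ (outsider-spec a∈y y∉S)
      ∉S-resp : ∀ {z w} → z ≡ w → inj₁ w ∉ S → inj₁ z ∉ S
      ∉S-resp refl w∉S = w∉S
      from-pairRow : PairRow y outsider a → Certificate (inj₁ y)
      from-pairRow (r , inj₁ (leader≡y , partner≡μ) , third≡a) =
        certify-pair r third≡a (λ eq → y≢μ (trans (sym leader≡y) (trans eq partner≡μ)))
          (∉S-resp leader≡y y∉S) (∉S-resp partner≡μ μ∉S)
          (trans (counterpart-of-other (a≢outside (∉S-resp partner≡μ μ∉S) ∘ sym)
                                       (λ eq → y≢μ (trans (sym leader≡y) eq))) leader≡y)
      from-pairRow (r , inj₂ (leader≡μ , partner≡y) , third≡a) =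
        certify-pair r third≡a (λ eq → y≢μ (trans (sym partner≡y) (trans (sym eq) leader≡μ)))
          (∉S-resp leader≡μ μ∉S) (∉S-resp partner≡y y∉S)
          (trans (counterpart-of-outsider (a≢outside (∉S-resp partner≡y y∉S) ∘ sym) leader≡μ) partner≡y)

    certificate : ∀ j → Certificate j
    certificate (inj₂ k) = certificate-with-a k
    certificate (inj₁ y) with inj₁ y ∈? S | a ∈ᵇ? y | y Fin.≟ outsider
    ... | yes y∈S | _ | _ = inj₁ y , inj₁ y∈S , refl
    ... | no y∉S | no a∉y | _ = certificate-facing-a y∉S a∉y
    ... | no _ | yes a∈y | yes y≡μ = certificate-outsider a∈y y≡μ
    ... | no y∉S | yes a∈y | no y≢μ = certificate-with-outsider y∉S a∈y y≢μ

    certificate-injective : ∀ {i j} → proj₁ (certificate (splitAt v i)) ≡ proj₁ (certificate (splitAt v j)) → i ≡ j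
    certificate-injective {i} {j} eq = begin
      i                                                  ≡⟨ join-splitAt v m i ⟨
      join v m (splitAt v i)                             ≡⟨ cong (join v m) (proj₂ (proj₂ (certificate (splitAt v i)))) ⟨
      join v m (label (proj₁ (certificate (splitAt v i)))) ≡⟨ cong (join v m ∘ label) eq ⟩
      join v m (label (proj₁ (certificate (splitAt v j)))) ≡⟨ cong (join v m) (proj₂ (proj₂ (certificate (splitAt v j)))) ⟩
      join v m (splitAt v j)                             ≡⟨ join-splitAt v m j ⟩
      j                                                  ∎
      where open ≡-Reasoning

    row-of-certificate : ∀ {j} ((σ , _) : Certificate j) → σ ∉ S → ∃ λ i → inj₂ i ∉ S × Leads rows i a S
    row-of-certificate (σ , inj₁ σ∈S , _) σ∉S = contradiction σ∈S σ∉S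
    row-of-certificate (_ , inj₂ (r , refl , r-leads) , _) σ∉S = encode r , σ∉S , leads-encode r-leads

    leading-row : length S < v + m → ∃ λ i → inj₂ i ∉ S × Leads rows i a S
    leading-row |S|< with j , σ∉S ← pigeonhole-∉ symbol-≟ S |S|< (proj₁ ∘ certificate ∘ splitAt v) certificate-injective
      = row-of-certificate (certificate (splitAt v j)) σ∉S

  suitableCore : ∀ t → t < v + m → SuitableCore N v t rows
  suitableCore t t<v+m = suitableCore-fromLeaders rows t λ a S |S|≡t a∈S →
    Certificates.leading-row a S a∈S (subst (_< v + m) (sym |S|≡t) t<v+m)

4≤nC3⇒4≤n : ∀ n → 4 ≤ n C 3 → 4 ≤ n
4≤nC3⇒4≤n (suc (suc (suc (suc _)))) _ = s≤s (s≤s (s≤s (s≤s z≤n)))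
4≤nC3⇒4≤n 3 (s≤s ())

lemma4 : (s l : ℕ) → s ≥ 1 → l ≥ 1 → l C 3 ≥ s + 3 → s + 3 ≥ l →
    ∃ λ (C : Array ((s + 3) * (s ∸ 1) + l) (s + 3)) →
      SuitableCore ((s + 3) * (s ∸ 1) + l) (s + 3) (2 * s + 1) C
lemma4 (suc m) l _ _ v≤lC3 l≤v = subst Core 4+m≡v (rows , suitableCore (2 * suc m + 1) (≤-reflexive (2s+2≡v+m m)))
  where
  Core : ℕ → Set
  Core w = ∃ λ (C : Array (w * m + l) w) → SuitableCore (w * m + l) w (2 * suc m + 1) C
  4+m≡v : 4 + m ≡ suc m + 3
  4+m≡v = cong suc (+-comm 3 m)
  2s+2≡v+m : ∀ m → suc (2 * suc m + 1) ≡ 4 + m + m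
  2s+2≡v+m = solve-∀
  l≤4+m : l ≤ 4 + m
  l≤4+m = subst (l ≤_) (sym 4+m≡v) l≤v
  4+m≤lC3 : 4 + m ≤ l C 3
  4+m≤lC3 = subst (_≤ l C 3) (sym 4+m≡v) v≤lC3
  open Construction m l l≤4+m (blockSystem (4≤nC3⇒4≤n l (≤-trans (m≤m+n 4 m) 4+m≤lC3)) l≤4+m 4+m≤lC3)
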